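{- Cut-free $\mathrm{RB}$ is hypersequent incomplete relative to $\mathbf{B}$ (reflexive and symmetric) Kripke frames: there is a hypersequent valid on all such frames that has no cut-free $\mathrm{RB}$ derivation, namely $J=\ \Rightarrow p\,/\!/\,\Rightarrow\Box(\neg\Box\Box p\land\neg\Box\Box q)\,/\!/\,\Rightarrow q$.
   Context: Hypersequents $S_1\,/\!/\,\dots\,/\!/\,S_n$ are finite lists of sequents $\Gamma\Rightarrow\Delta$. A Kripke model is a countermodel to $\Gamma_1\Rightarrow\Delta_1\,/\!/\,\dots\,/\!/\,\Gamma_n\Rightarrow\Delta_n$ if there is a branch $w_1,\dots,w_n$ ($w_iRw_{i+1}$) with all of $\Gamma_i$ true and all of $\Delta_i$ false at $w_i$; validity is absence of countermodels. Cut-free $\mathrm{RB}$ has: axiom $p\Rightarrow p$; external weakening at the ends; internal weakening; the usual rules for $\neg,\land,\lor$ in any component; $\Box\mathrm{R}$: from $G\,/\!/\,\Gamma\Rightarrow\Delta\,/\!/\,\Rightarrow\phi$ infer $G\,/\!/\,\Gamma\Rightarrow\Box\phi,\Delta$; $\Box\mathrm{L}$: from $G\,/\!/\,\Gamma\Rightarrow\Delta\,/\!/\,\Sigma,\phi\Rightarrow\Lambda\,/\!/\,H$ infer $G\,/\!/\,\Gamma,\Box\phi\Rightarrow\Delta\,/\!/\,\Sigma\Rightarrow\Lambda\,/\!/\,H$; $Sym$ (reverse the list of components); and $EC$ (contract two adjacent identical components). -}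

module Defs where

open import Data.Nat using (ℕ)
open import Data.Bool using (Bool; true)
open import Data.List using (List; []; _∷_; _++_; [_]; reverse)
open import Data.List.Relation.Binary.Permutation.Propositional using (_↭_)
open import Data.Product using (_×_; _,_; Σ)
open import Data.Empty using (⊥)
open import Relation.Nullary using (¬_)
open import Relation.Binary.PropositionalEquality using (_≡_)

data Fm : Set where
  atom : ℕ → Fm
  ~_   : Fm → Fm
  _∧_  : Fm → Fm → Fm
  _∨_  : Fm → Fm → Fm
  □_   : Fm → Fm

infixr 6 _∧_
infixr 5 _∨_
infix 7 ~_ □_

-- A sequent Γ ⇒ Δ (antecedent, succedent); a hypersequent is a list of sequents.
Sequent : Set
Sequent = List Fm × List Fm

HSeq : Set
HSeq = List Sequent

record Model : Set₁ where
  field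
    W : Set
    R : W → W → Set
    V : W → ℕ → Bool

open Model public

_,_⊩_ : (M : Model) → W M → Fm → Set
M , w ⊩ atom a = V M w a ≡ true
M , w ⊩ (~ φ) = ¬ (M , w ⊩ φ)
M , w ⊩ (φ ∧ ψ) = (M , w ⊩ φ) × (M , w ⊩ ψ)
M , w ⊩ (φ ∨ ψ) = (M , w ⊩ φ) Data.Sum.⊎ (M , w ⊩ ψ)
  where import Data.Sum
M , w ⊩ (□ φ) = ∀ v → R M w v → M , v ⊩ φ

AllTrue : (M : Model) → W M → List Fm → Set
AllTrue M w [] = Data.Unit.⊤ where import Data.Unit
AllTrue M w (φ ∷ Γ) = (M , w ⊩ φ) × AllTrue M w Γ

AllFalse : (M : Model) → W M → List Fm → Set
AllFalse M w [] = Data.Unit.⊤ where import Data.Unit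
AllFalse M w (φ ∷ Δ) = ¬ (M , w ⊩ φ) × AllFalse M w Δ

RefutedFrom : (M : Model) → W M → HSeq → Set
RefutedFrom M w [] = Data.Unit.⊤ where import Data.Unit
RefutedFrom M w ((Γ , Δ) ∷ []) = AllTrue M w Γ × AllFalse M w Δ
RefutedFrom M w ((Γ , Δ) ∷ S ∷ H) =
  AllTrue M w Γ × AllFalse M w Δ × Σ (W M) (λ v → R M w v × RefutedFrom M v (S ∷ H))

Countermodel : Model → HSeq → Set
Countermodel M [] = ⊥   -- convention for the empty hypersequent (irrelevant here)
Countermodel M (S ∷ H) = Σ (W M) (λ w → RefutedFrom M w (S ∷ H))

IsB : Model → Set
IsB M = (∀ w → R M w w) × (∀ w v → R M w v → R M v w)

ValidB : HSeq → Set₁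
ValidB H = (M : Model) → IsB M → ¬ Countermodel M H

-- Cut-free RB
-- Comma-extension of a context is written φ ∷ Γ; order inside a
-- component is immaterial thanks to the exchange rule Perm.

data RB : HSeq → Set where
  ax    : ∀ a → RB [ ([ atom a ] , [ atom a ]) ]
  EWl   : ∀ S H → RB H → RB (S ∷ H)
  EWr   : ∀ S H → RB H → RB (H ++ [ S ])
  IWl   : ∀ G H Γ Δ φ → RB (G ++ (Γ , Δ) ∷ H) → RB (G ++ (φ ∷ Γ , Δ) ∷ H)
  IWr   : ∀ G H Γ Δ φ → RB (G ++ (Γ , Δ) ∷ H) → RB (G ++ (Γ , φ ∷ Δ) ∷ H)
  Perm  : ∀ G H Γ Δ Γ' Δ' → Γ ↭ Γ' → Δ ↭ Δ' →
          RB (G ++ (Γ , Δ) ∷ H) → RB (G ++ (Γ' , Δ') ∷ H)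
  ¬L    : ∀ G H Γ Δ φ → RB (G ++ (Γ , φ ∷ Δ) ∷ H) → RB (G ++ ((~ φ) ∷ Γ , Δ) ∷ H)
  ¬R    : ∀ G H Γ Δ φ → RB (G ++ (φ ∷ Γ , Δ) ∷ H) → RB (G ++ (Γ , (~ φ) ∷ Δ) ∷ H)
  ∧L    : ∀ G H Γ Δ φ ψ → RB (G ++ (φ ∷ ψ ∷ Γ , Δ) ∷ H) → RB (G ++ ((φ ∧ ψ) ∷ Γ , Δ) ∷ H)
  ∧R    : ∀ G H Γ Δ φ ψ → RB (G ++ (Γ , φ ∷ Δ) ∷ H) → RB (G ++ (Γ , ψ ∷ Δ) ∷ H) →
          RB (G ++ (Γ , (φ ∧ ψ) ∷ Δ) ∷ H)
  ∨L    : ∀ G H Γ Δ φ ψ → RB (G ++ (φ ∷ Γ , Δ) ∷ H) → RB (G ++ (ψ ∷ Γ , Δ) ∷ H) →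
          RB (G ++ ((φ ∨ ψ) ∷ Γ , Δ) ∷ H)
  ∨R    : ∀ G H Γ Δ φ ψ → RB (G ++ (Γ , φ ∷ ψ ∷ Δ) ∷ H) → RB (G ++ (Γ , (φ ∨ ψ) ∷ Δ) ∷ H)
  □R    : ∀ G Γ Δ φ → RB (G ++ (Γ , Δ) ∷ [ ([] , [ φ ]) ]) → RB (G ++ [ (Γ , (□ φ) ∷ Δ) ])
  □L    : ∀ G H Γ Δ Σ' Λ φ → RB (G ++ (Γ , Δ) ∷ (φ ∷ Σ' , Λ) ∷ H) →
          RB (G ++ ((□ φ) ∷ Γ , Δ) ∷ (Σ' , Λ) ∷ H)
  Sym   : ∀ H → RB H → RB (reverse H)
  EC    : ∀ G H S → RB (G ++ S ∷ S ∷ H) → RB (G ++ S ∷ H)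

p q : Fm
p = atom 0
q = atom 1

J : HSeq
J = ([] , [ p ]) ∷ ([] , [ □ ((~ (□ (□ p))) ∧ (~ (□ (□ q)))) ]) ∷ ([] , [ q ]) ∷ []

-- Validity: in a refutation w₁ R w₂ R w₃ of J, the world w₂ refutes □(¬□□p ∧ ¬□□q), so it
-- sees some v with □□p or □□q; by symmetry v R w₂ R w₁ and v R w₂ R w₃, contradicting ¬p at w₁
-- or ¬q at w₃.
--
-- Underivability: call a hypersequent sorted if each component is one of ⇒p, ⇒□X, ⇒q, ⇒
-- (X = ¬□□p ∧ ¬□□q) and the non-empty ones occur in the order of J, or in the reverse order.
-- Read upwards, every rule either fails to apply to a sorted hypersequent or yields a sorted
-- premise, except □R introducing □X as the last component. Then the other components are
-- ⇒p, ⇒□X, ⇒ (or ⇒q, ⇒□X, ⇒ in the reverse order), and the premise is already false at a single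
-- reflexive world where p is false and q true (or vice versa), so it is not derivable either.

module Submission where

open import Defs
open import Data.Bool using (Bool; true; false; not)
import Data.Bool as Bool
open import Data.Bool.Properties using (∧-conicalˡ; ∧-conicalʳ; ∨-conicalˡ; ∨-conicalʳ; not-injective)
open import Data.List using ([]; _∷_; _++_; [_]; reverse)
open import Data.List.Properties using (unfold-reverse)
open import Data.List.Relation.Binary.Permutation.Propositional using (_↭_; ↭-sym)
open import Data.List.Relation.Binary.Permutation.Propositional.Properties
  using (All-resp-↭; ↭-reverse; ↭-empty-inv; ↭-singleton-inv)
open import Data.List.Relation.Unary.All as All using (All; []; _∷_)
import Data.List.Relation.Unary.All.Properties as All
open import Data.List.Relation.Unary.AllPairs as AllPairs using (AllPairs; []; _∷_)
open import Data.Nat using (ℕ; zero; suc)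
open import Data.Product using (_×_; _,_; ∃; proj₁; proj₂)
open import Data.Sum using (_⊎_; inj₁; inj₂)
open import Function using (flip; _∘′_)
open import Relation.Binary.PropositionalEquality using (_≡_; refl; sym; subst)
open import Relation.Nullary using (¬_)

validB-J : ValidB J
validB-J M (_ , symmetric) (w₁ , _ , (⊭p , _) , w₂ , w₁Rw₂ , _ , (⊭□X , _) , w₃ , w₂Rw₃ , _ , (⊭q , _)) =
  ⊭□X λ v w₂Rv →
    (λ ⊩□□p → ⊭p (⊩□□p w₂ (symmetric w₂ v w₂Rv) w₁ (symmetric w₁ w₂ w₁Rw₂))) ,
    (λ ⊩□□q → ⊭q (⊩□□q w₂ (symmetric w₂ v w₂Rv) w₃ w₂Rw₃))

module _ {a} {A : Set a} where

  All-at : ∀ {p} {P : A → Set p} G {H c} → All P (G ++ c ∷ H) → P c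
  All-at G = All.head ∘′ All.++⁻ʳ G

  All-modify : ∀ {p} {P : A → Set p} G {H c c′} →
               (P c → P c′) → All P (G ++ c ∷ H) → All P (G ++ c′ ∷ H)
  All-modify G f s with All.++⁻ G s
  ... | s₁ , pc ∷ s₂ = All.++⁺ s₁ (f pc ∷ s₂)

  All-duplicate : ∀ {p} {P : A → Set p} G {H c} → All P (G ++ c ∷ H) → All P (G ++ c ∷ c ∷ H)
  All-duplicate G s with All.++⁻ G s
  ... | s₁ , pc ∷ s₂ = All.++⁺ s₁ (pc ∷ pc ∷ s₂)

  module _ {r} {R : A → A → Set r} where

    AllPairs-∷ʳ⁻ : ∀ xs {x} → AllPairs R (xs ++ [ x ]) → AllPairs R xs × All (λ y → R y x) xs
    AllPairs-∷ʳ⁻ [] _ = [] , []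
    AllPairs-∷ʳ⁻ (y ∷ xs) (r ∷ rs) with AllPairs-∷ʳ⁻ xs rs
    ... | ps , qs = All.++⁻ˡ xs r ∷ ps , All-at xs r ∷ qs

    AllPairs-reverse⁻ : ∀ xs → AllPairs R (reverse xs) → AllPairs (flip R) xs
    AllPairs-reverse⁻ [] _ = []
    AllPairs-reverse⁻ (x ∷ xs) rs
      with AllPairs-∷ʳ⁻ (reverse xs) (subst (AllPairs R) (unfold-reverse x xs) rs)
    ... | ps , qs = All-resp-↭ (↭-reverse xs) qs ∷ AllPairs-reverse⁻ xs ps

    AllPairs-duplicate : ∀ G {H c} → R c c → AllPairs R (G ++ c ∷ H) → AllPairs R (G ++ c ∷ c ∷ H)
    AllPairs-duplicate [] r (h ∷ t) = (r ∷ h) ∷ h ∷ t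
    AllPairs-duplicate (_ ∷ G) r (h ∷ t) = All-duplicate G h ∷ AllPairs-duplicate G r t

    AllPairs-replace-by-neutral : ∀ G {H c c′} → (∀ {y} → R y c′) → (∀ {y} → R c′ y) →
                                  AllPairs R (G ++ c ∷ H) → AllPairs R (G ++ c′ ∷ H)
    AllPairs-replace-by-neutral [] _ r (h ∷ t) = All.map (λ _ → r) h ∷ t
    AllPairs-replace-by-neutral (_ ∷ G) l r (h ∷ t) =
      All-modify G (λ _ → l) h ∷ AllPairs-replace-by-neutral G l r t

-- Truth at the one-world reflexive model, where □φ is equivalent to φ.
⟦_⟧ : Fm → (ℕ → Bool) → Bool
⟦ atom n ⟧ v = v n
⟦ ~ φ ⟧ v = not (⟦ φ ⟧ v)
⟦ φ ∧ ψ ⟧ v = ⟦ φ ⟧ v Bool.∧ ⟦ ψ ⟧ v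
⟦ φ ∨ ψ ⟧ v = ⟦ φ ⟧ v Bool.∨ ⟦ ψ ⟧ v
⟦ □ φ ⟧ v = ⟦ φ ⟧ v

Refutes : (ℕ → Bool) → Sequent → Set
Refutes v (Γ , Δ) = All (λ φ → ⟦ φ ⟧ v ≡ true) Γ × All (λ φ → ⟦ φ ⟧ v ≡ false) Δ

∧-false : ∀ x y → x Bool.∧ y ≡ false → x ≡ false ⊎ y ≡ false
∧-false false _ _ = inj₁ refl
∧-false true _ e = inj₂ e

∨-true : ∀ x y → x Bool.∨ y ≡ true → x ≡ true ⊎ y ≡ true
∨-true true _ _ = inj₁ refl
∨-true false _ e = inj₂ e

RB-one-world-sound : ∀ v {H} → RB H → ¬ All (Refutes v) H
RB-one-world-sound v (ax _) ((t ∷ [] , f ∷ []) ∷ []) with () ← subst (_≡ false) t f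
RB-one-world-sound v (EWl _ _ d) (_ ∷ s) = RB-one-world-sound v d s
RB-one-world-sound v (EWr _ H d) s = RB-one-world-sound v d (All.++⁻ˡ H s)
RB-one-world-sound v (IWl G _ _ _ _ d) s =
  RB-one-world-sound v d (All-modify G (λ { (_ ∷ γ , δ) → γ , δ }) s)
RB-one-world-sound v (IWr G _ _ _ _ d) s =
  RB-one-world-sound v d (All-modify G (λ { (γ , _ ∷ δ) → γ , δ }) s)
RB-one-world-sound v (Perm G _ _ _ _ _ pΓ pΔ d) s =
  RB-one-world-sound v d
    (All-modify G (λ { (γ , δ) → All-resp-↭ (↭-sym pΓ) γ , All-resp-↭ (↭-sym pΔ) δ }) s)
RB-one-world-sound v (¬L G _ _ _ _ d) s =
  RB-one-world-sound v d (All-modify G (λ { (e ∷ γ , δ) → γ , not-injective e ∷ δ }) s)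
RB-one-world-sound v (¬R G _ _ _ _ d) s =
  RB-one-world-sound v d (All-modify G (λ { (γ , e ∷ δ) → not-injective e ∷ γ , δ }) s)
RB-one-world-sound v (∧L G _ _ _ _ _ d) s =
  RB-one-world-sound v d
    (All-modify G (λ { (e ∷ γ , δ) → ∧-conicalˡ _ _ e ∷ ∧-conicalʳ _ _ e ∷ γ , δ }) s)
RB-one-world-sound v (∧R G _ _ _ φ ψ d₁ d₂) s
  with ∧-false (⟦ φ ⟧ v) (⟦ ψ ⟧ v) (All.head (proj₂ (All-at G s)))
... | inj₁ e = RB-one-world-sound v d₁ (All-modify G (λ { (γ , _ ∷ δ) → γ , e ∷ δ }) s)
... | inj₂ e = RB-one-world-sound v d₂ (All-modify G (λ { (γ , _ ∷ δ) → γ , e ∷ δ }) s)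
RB-one-world-sound v (∨L G _ _ _ φ ψ d₁ d₂) s
  with ∨-true (⟦ φ ⟧ v) (⟦ ψ ⟧ v) (All.head (proj₁ (All-at G s)))
... | inj₁ e = RB-one-world-sound v d₁ (All-modify G (λ { (_ ∷ γ , δ) → e ∷ γ , δ }) s)
... | inj₂ e = RB-one-world-sound v d₂ (All-modify G (λ { (_ ∷ γ , δ) → e ∷ γ , δ }) s)
RB-one-world-sound v (∨R G _ _ _ _ _ d) s =
  RB-one-world-sound v d
    (All-modify G (λ { (γ , e ∷ δ) → γ , ∨-conicalˡ _ _ e ∷ ∨-conicalʳ _ _ e ∷ δ }) s)
RB-one-world-sound v (□R G _ _ _ d) s with All.++⁻ G s
... | s₁ , (γ , e ∷ δ) ∷ [] = RB-one-world-sound v d (All.++⁺ s₁ ((γ , δ) ∷ ([] , e ∷ []) ∷ []))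
RB-one-world-sound v (□L G _ _ _ _ _ _ d) s with All.++⁻ G s
... | s₁ , (e ∷ γ , δ) ∷ (σ , λ′) ∷ s₂ =
  RB-one-world-sound v d (All.++⁺ s₁ ((γ , δ) ∷ (e ∷ σ , λ′) ∷ s₂))
RB-one-world-sound v (Sym H d) s = RB-one-world-sound v d (All-resp-↭ (↭-reverse H) s)
RB-one-world-sound v (EC G _ _ d) s = RB-one-world-sound v d (All-duplicate G s)

X : Fm
X = (~ (□ (□ p))) ∧ (~ (□ (□ q)))

data Kind : Set where
  P B Q E : Kind

data JComponent : Kind → Sequent → Set where
  ⇒p  : JComponent P ([] , [ p ])
  ⇒□X : JComponent B ([] , [ □ X ])
  ⇒q  : JComponent Q ([] , [ q ])
  ⇒   : JComponent E ([] , [])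

JLike : Sequent → Set
JLike S = ∃ λ k → JComponent k S

data _≼_ : Kind → Kind → Set where
  ≼-refl : ∀ {k} → k ≼ k
  P≼B : P ≼ B
  P≼Q : P ≼ Q
  B≼Q : B ≼ Q
  ≼E : ∀ {k} → k ≼ E
  E≼ : ∀ {k} → E ≼ k

data Orientation : Set where
  forward backward : Orientation

opposite : Orientation → Orientation
opposite forward = backward
opposite backward = forward

Precedes : Orientation → Kind → Kind → Set
Precedes forward = _≼_
Precedes backward = flip _≼_

Precedes-refl : ∀ o {k} → Precedes o k k
Precedes-refl forward = ≼-refl
Precedes-refl backward = ≼-refl

Precedes-E : ∀ o {k} → Precedes o k E
Precedes-E forward = ≼E
Precedes-E backward = E≼

E-Precedes : ∀ o {k} → Precedes o E k
E-Precedes forward = E≼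
E-Precedes backward = ≼E

Precedes-opposite : ∀ o {k l} → Precedes o l k → Precedes (opposite o) k l
Precedes-opposite forward r = r
Precedes-opposite backward r = r

InOrder : Orientation → Sequent → Sequent → Set
InOrder o S T = ∀ {k l} → JComponent k S → JComponent l T → Precedes o k l

Sorted : Orientation → HSeq → Set
Sorted o H = All JLike H × AllPairs (InOrder o) H

InOrder-refl : ∀ o S → InOrder o S S
InOrder-refl o _ ⇒p ⇒p = Precedes-refl o
InOrder-refl o _ ⇒□X ⇒□X = Precedes-refl o
InOrder-refl o _ ⇒q ⇒q = Precedes-refl o
InOrder-refl o _ ⇒ ⇒ = Precedes-refl o

JLike-↭ : ∀ {Γ Γ′ Δ Δ′} → Γ ↭ Γ′ → Δ ↭ Δ′ → JLike (Γ′ , Δ′) → (Γ , Δ) ≡ (Γ′ , Δ′)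
JLike-↭ pΓ pΔ (_ , ⇒p) rewrite ↭-empty-inv pΓ | ↭-singleton-inv pΔ = refl
JLike-↭ pΓ pΔ (_ , ⇒□X) rewrite ↭-empty-inv pΓ | ↭-singleton-inv pΔ = refl
JLike-↭ pΓ pΔ (_ , ⇒q) rewrite ↭-empty-inv pΓ | ↭-singleton-inv pΔ = refl
JLike-↭ pΓ pΔ (_ , ⇒) rewrite ↭-empty-inv pΓ | ↭-empty-inv pΔ = refl

JLike-weakenʳ : ∀ {Γ Δ φ} → JLike (Γ , φ ∷ Δ) → (Γ , Δ) ≡ ([] , [])
JLike-weakenʳ (_ , ⇒p) = refl
JLike-weakenʳ (_ , ⇒□X) = refl
JLike-weakenʳ (_ , ⇒q) = refl

¬JLike-antecedent : ∀ {φ Γ Δ} → ¬ JLike (φ ∷ Γ , Δ)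
¬JLike-antecedent (_ , ())

module _ (o : Orientation) where

  Sorted-at : ∀ G {H c} → Sorted o (G ++ c ∷ H) → JLike c
  Sorted-at G = All-at G ∘′ proj₁

  Sorted-∷ʳ⁻ : ∀ H {S} → Sorted o (H ++ [ S ]) → Sorted o H
  Sorted-∷ʳ⁻ H (js , ps) = All.++⁻ˡ H js , proj₁ (AllPairs-∷ʳ⁻ H ps)

  Sorted-reverse⁻ : ∀ H → Sorted o (reverse H) → Sorted (opposite o) H
  Sorted-reverse⁻ H (js , ps) =
    All-resp-↭ (↭-reverse H) js ,
    AllPairs.map (λ r {_} {_} jS jT → Precedes-opposite o (r jT jS)) (AllPairs-reverse⁻ H ps)

  Sorted-duplicate : ∀ G {H c} → Sorted o (G ++ c ∷ H) → Sorted o (G ++ c ∷ c ∷ H)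
  Sorted-duplicate G (js , ps) = All-duplicate G js , AllPairs-duplicate G (InOrder-refl o _) ps

  Sorted-empty : ∀ G {H c} → Sorted o (G ++ c ∷ H) → Sorted o (G ++ ([] , []) ∷ H)
  Sorted-empty G (js , ps) =
    All-modify G (λ _ → E , ⇒) js ,
    AllPairs-replace-by-neutral G (λ { _ ⇒ → Precedes-E o }) (λ { ⇒ _ → E-Precedes o }) ps

countervaluation : Orientation → ℕ → Bool
countervaluation forward zero = false
countervaluation forward (suc _) = true
countervaluation backward zero = true
countervaluation backward (suc _) = false

countervaluation-refutes-X : ∀ o → ⟦ X ⟧ (countervaluation o) ≡ false
countervaluation-refutes-X forward = refl
countervaluation-refutes-X backward = refl

countervaluation-refutes : ∀ o {k S} → JComponent k S → Precedes o k B →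
                           Refutes (countervaluation o) S
countervaluation-refutes forward ⇒p _ = [] , refl ∷ []
countervaluation-refutes forward ⇒□X _ = [] , refl ∷ []
countervaluation-refutes forward ⇒ _ = [] , []
countervaluation-refutes backward ⇒q _ = [] , refl ∷ []
countervaluation-refutes backward ⇒□X _ = [] , refl ∷ []
countervaluation-refutes backward ⇒ _ = [] , []

Sorted-before-□X-refuted : ∀ o G → Sorted o (G ++ [ ([] , [ □ X ]) ]) →
                            All (Refutes (countervaluation o)) G
Sorted-before-□X-refuted o G (js , ps) =
  All.zipWith (λ { ((_ , j) , r) → countervaluation-refutes o j (r j ⇒□X) })
    (All.++⁻ˡ G js , proj₂ (AllPairs-∷ʳ⁻ G ps))

RB-¬Sorted : ∀ o {H} → RB H → ¬ Sorted o H
RB-¬Sorted o (ax _) s = ¬JLike-antecedent (Sorted-at o [] s)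
RB-¬Sorted o (EWl _ _ d) (_ ∷ js , _ ∷ ps) = RB-¬Sorted o d (js , ps)
RB-¬Sorted o (EWr _ H d) s = RB-¬Sorted o d (Sorted-∷ʳ⁻ o H s)
RB-¬Sorted o (IWl G _ _ _ _ _) s = ¬JLike-antecedent (Sorted-at o G s)
RB-¬Sorted o (IWr G H _ _ _ d) s =
  RB-¬Sorted o d (subst (λ c → Sorted o (G ++ c ∷ H)) (sym (JLike-weakenʳ (Sorted-at o G s)))
                        (Sorted-empty o G s))
RB-¬Sorted o (Perm G H _ _ _ _ pΓ pΔ d) s =
  RB-¬Sorted o d (subst (λ c → Sorted o (G ++ c ∷ H)) (sym (JLike-↭ pΓ pΔ (Sorted-at o G s))) s)
RB-¬Sorted o (¬L G _ _ _ _ _) s = ¬JLike-antecedent (Sorted-at o G s)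
RB-¬Sorted o (¬R G _ _ _ _ _) s with Sorted-at o G s
... | _ , ()
RB-¬Sorted o (∧L G _ _ _ _ _ _) s = ¬JLike-antecedent (Sorted-at o G s)
RB-¬Sorted o (∧R G _ _ _ _ _ _ _) s with Sorted-at o G s
... | _ , ()
RB-¬Sorted o (∨L G _ _ _ _ _ _ _) s = ¬JLike-antecedent (Sorted-at o G s)
RB-¬Sorted o (∨R G _ _ _ _ _ _) s with Sorted-at o G s
... | _ , ()
RB-¬Sorted o (□R G _ _ _ d) s with Sorted-at o G s
... | _ , ⇒□X =
  RB-one-world-sound (countervaluation o) d
    (All.++⁺ (Sorted-before-□X-refuted o G s)
             (([] , []) ∷ ([] , countervaluation-refutes-X o ∷ []) ∷ []))
RB-¬Sorted o (□L G _ _ _ _ _ _ _) s = ¬JLike-antecedent (Sorted-at o G s)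
RB-¬Sorted o (Sym H d) s = RB-¬Sorted (opposite o) d (Sorted-reverse⁻ o H s)
RB-¬Sorted o (EC G _ _ d) s = RB-¬Sorted o d (Sorted-duplicate o G s)

Sorted-J : Sorted forward J
Sorted-J =
  ((P , ⇒p) ∷ (B , ⇒□X) ∷ (Q , ⇒q) ∷ []) ,
  ((λ { ⇒p ⇒□X → P≼B }) ∷ (λ { ⇒p ⇒q → P≼Q }) ∷ []) ∷ ((λ { ⇒□X ⇒q → B≼Q }) ∷ []) ∷ [] ∷ []

mainTheorem19 : ValidB J × ¬ RB J
mainTheorem19 = validB-J , λ d → RB-¬Sorted forward d Sorted-J
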